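{- Let $F$ be a Ferrers diagram and let $(x,y)\in\mathbb{N}^2$ with $x>1$, $y>1$ and $(x,y)\notin F$. Then the divisor $D_{x,y}=\sum_{(x',y')\in F,\ x'\ne x,\ y'\ne y}(x',y')$ on the Ferrers rook graph $R(F)$ has positive rank.
   Context: $\mathbb{N}=\{1,2,3,\dots\}$. A Ferrers diagram is a finite set $F\subset\mathbb{N}^2$ such that if $(x,y)\in F$ then ($x=1$ or $(x-1,y)\in F$) and ($y=1$ or $(x,y-1)\in F$). Here $x$ indexes the column and $y$ the row. The Ferrers rook graph $R(F)$ is the simple graph with vertex set $F$ in which distinct $(x,y),(x',y')$ are adjacent iff $x=x'$ or $y=y'$. Divisors, chip firing and equivalence are as usual: firing a vertex sends one chip along each incident edge to each neighbor. An effective divisor $D$ (all coefficients $\ge0$) has positive rank if for every vertex $v$ there is an effective divisor equivalent to $D$ with a positive number of chips at $v$. -}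

module Defs where

open import Data.Nat using (ℕ; suc; _≤_; _<_)
import Data.Nat as ℕ
open import Data.Integer using (ℤ; _+_; _-_; 0ℤ; 1ℤ) renaming (_≤_ to _≤ℤ_; _<_ to _<ℤ_)
open import Data.Product using (_×_; _,_; proj₁; proj₂; ∃)
open import Data.Sum using (_⊎_)
open import Data.Bool using (Bool; true; false; if_then_else_; _∧_; _∨_; not)
open import Data.List using (List; map; foldr)
open import Data.List.Membership.Propositional using (_∈_)
open import Data.List.Relation.Unary.Unique.Propositional using (Unique)
open import Relation.Binary.PropositionalEquality using (_≡_)
open import Relation.Nullary.Decidable using (⌊_⌋)

-- A cell (x , y) of ℕ²: x = column, y = row.  ℕ = {1,2,3,...} is encoded
-- as natural numbers ≥ 1.
Cell : Set
Cell = ℕ × ℕ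

record IsFerrers (F : List Cell) : Set where
  field
    unique : Unique F
    positive : ∀ x y → (x , y) ∈ F → (1 ≤ x × 1 ≤ y)
    closedˣ : ∀ x y → (suc (suc x) , y) ∈ F → (suc x , y) ∈ F
    closedʸ : ∀ x y → (x , suc (suc y)) ∈ F → (x , suc y) ∈ F

_==_ : Cell → Cell → Bool
(x , y) == (x' , y') = ⌊ x ℕ.≟ x' ⌋ ∧ ⌊ y ℕ.≟ y' ⌋

adj : Cell → Cell → Bool
adj (x , y) (x' , y') =
  not ((x , y) == (x' , y')) ∧ (⌊ x ℕ.≟ x' ⌋ ∨ ⌊ y ℕ.≟ y' ⌋)

-- Divisors on R(F): integer functions on cells (only values on F matter).
Divisor : Set
Divisor = Cell → ℤ

sumℤ : List ℤ → ℤ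
sumℤ = foldr _+_ 0ℤ

-- Effect of firing script f (vertex u fired f u times) at vertex v:
-- D'(v) = D(v) - deg(v) f(v) + Σ_{u ~ v} f(u) = D(v) + Σ_{u ~ v} (f u - f v).
fireAt : List Cell → (Cell → ℤ) → Divisor → Cell → ℤ
fireAt F f D v = D v + sumℤ (map (λ u → if adj u v then f u - f v else 0ℤ) F)

_∼[_]_ : Divisor → List Cell → Divisor → Set
D ∼[ F ] D' = ∃ λ (f : Cell → ℤ) → ∀ v → v ∈ F → D' v ≡ fireAt F f D v

Effective : List Cell → Divisor → Set
Effective F D = ∀ v → v ∈ F → 0ℤ ≤ℤ D v

PositiveRank : List Cell → Divisor → Set
PositiveRank F D =
  Effective F D ×
  (∀ v → v ∈ F → ∃ λ (D' : Divisor) → Effective F D' × (D ∼[ F ] D') × (0ℤ <ℤ D' v))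

Dxy : ℕ → ℕ → Divisor
Dxy x y (x' , y') = if not ⌊ x ℕ.≟ x' ⌋ ∧ not ⌊ y ℕ.≟ y' ⌋ then 1ℤ else 0ℤ

{-# OPTIONS --safe #-}
module Submission where

-- Every cell off column x and row y already carries a chip of D = D_{x,y}.
-- A cell (x , b) of column x gets one when all cells off column x are fired:
-- (x , b) gains a chip from (1 , b), which lies in F because F is a Ferrers
-- diagram and x > 1, while a cell (a , b) with a ≠ x loses at most the chip
-- it sends to (x , b), and only if (x , b) ∈ F; but then b ≠ y because
-- (x , y) ∉ F, so (a , b) carried a chip.  Rows are symmetric.

open import Defs
open import Data.Bool using (Bool; true; false; not; if_then_else_)
open import Data.Bool.Properties using (if-eta; ¬-not)
open import Data.Empty using (⊥-elim)
open import Data.Integer using (ℤ; _+_; _-_; 0ℤ; 1ℤ; -1ℤ)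
  renaming (_≤_ to _≤ℤ_; _<_ to _<ℤ_)
open import Data.Integer.Base using (+≤+; +<+; -≤+; nonNegative)
open import Data.Integer.Properties
  using (≤-refl; ≤-trans; ≤-reflexive; ≤-<-trans; +-mono-≤; +-mono-<-≤; +-mono-≤-<;
         +-monoʳ-≤; +-monoʳ-<; +-identityʳ; i≤i+j; i≤j⇒0≤j-i)
open import Data.List using (List; []; _∷_; map)
open import Data.List.Membership.Propositional using (_∈_; _∉_)
open import Data.List.Relation.Unary.All using () renaming (lookup to All-lookup)
open import Data.List.Relation.Unary.AllPairs using (_∷_)
open import Data.List.Relation.Unary.Any using (here; there)
open import Data.List.Relation.Unary.Unique.Propositional using (Unique)
open import Data.Nat using (ℕ; zero; suc; _<_; z≤n; s≤s; _≟_)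
open import Data.Nat.Properties using (<⇒≢)
open import Data.Product using (_×_; _,_; ∃)
open import Data.Product.Properties using (≡-dec)
open import Data.Sum using (_⊎_; inj₁; inj₂)
open import Function using (const)
open import Relation.Binary.Definitions using (DecidableEquality)
open import Relation.Binary.PropositionalEquality
  using (_≡_; _≢_; refl; sym; cong; cong₂; subst; ≢-sym; module ≡-Reasoning)
open import Relation.Nullary using (yes; no)
open import Relation.Nullary.Decidable using (⌊_⌋)

_≟ᶜ_ : DecidableEquality Cell
_≟ᶜ_ = ≡-dec _≟_ _≟_

open import Data.List.Membership.DecPropositional _≟ᶜ_ using (_∈?_)

module _ {A : Set} {g : A → ℤ} where

  sum-zero : ∀ L → (∀ u → g u ≡ 0ℤ) → sumℤ (map g L) ≡ 0ℤ
  sum-zero []      _   = refl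
  sum-zero (a ∷ L) g≡0 = cong₂ _+_ (g≡0 a) (sum-zero L g≡0)

  sum-nonneg : ∀ L → (∀ u → u ∈ L → 0ℤ ≤ℤ g u) → 0ℤ ≤ℤ sumℤ (map g L)
  sum-nonneg []      _   = ≤-refl
  sum-nonneg (a ∷ L) g≥0 =
    +-mono-≤ (g≥0 a (here refl)) (sum-nonneg L (λ u u∈L → g≥0 u (there u∈L)))

  sum-pos : ∀ {L w} → (∀ u → u ∈ L → 0ℤ ≤ℤ g u) → w ∈ L → 0ℤ <ℤ g w →
            0ℤ <ℤ sumℤ (map g L)
  sum-pos {a ∷ L} g≥0 (here refl) gw>0 =
    +-mono-<-≤ gw>0 (sum-nonneg L (λ u u∈L → g≥0 u (there u∈L)))
  sum-pos {a ∷ L} g≥0 (there w∈L) gw>0 =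
    +-mono-≤-< (g≥0 a (here refl)) (sum-pos (λ u u∈L → g≥0 u (there u∈L)) w∈L gw>0)

  sum-≥-1 : DecidableEquality A → ∀ {L} c → Unique L →
            (∀ u → u ∈ L → u ≢ c → 0ℤ ≤ℤ g u) → -1ℤ ≤ℤ g c →
            -1ℤ ≤ℤ sumℤ (map g L)
  sum-≥-1 _≟ᴬ_ {[]}    c _              _   _     = -≤+
  sum-≥-1 _≟ᴬ_ {a ∷ L} c (a∉L ∷ unique) g≥0 gc≥-1 with a ≟ᴬ c
  ... | yes refl = +-mono-≤ gc≥-1
        (sum-nonneg L (λ u u∈L → g≥0 u (there u∈L) (≢-sym (All-lookup a∉L u∈L))))
  ... | no a≢c   = +-mono-≤ (g≥0 a (here refl) a≢c)
        (sum-≥-1 _≟ᴬ_ c unique (λ u u∈L → g≥0 u (there u∈L)) gc≥-1)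

inflow : (Cell → ℤ) → Cell → Cell → ℤ
inflow f v u = if adj u v then f u - f v else 0ℤ

indicator : (Cell → Bool) → Cell → ℤ
indicator S u = if S u then 1ℤ else 0ℤ

module _ (S : Cell → Bool) where

  inflow-outside-nonneg : ∀ {v} → S v ≡ false → ∀ u → 0ℤ ≤ℤ inflow (indicator S) v u
  inflow-outside-nonneg {v} Sv u with adj u v | S u | S v
  ... | false | _     | _     = ≤-refl
  ... | true  | false | false = ≤-refl
  ... | true  | true  | false = +≤+ z≤n

  inflow-outside-pos : ∀ {u v} → S v ≡ false → adj u v ≡ true → S u ≡ true →
                       0ℤ <ℤ inflow (indicator S) v u
  inflow-outside-pos {u} {v} Sv uv Su with adj u v | S u | S v
  ... | true | true | false = +<+ (s≤s z≤n)

  inflow-inside-≥-1 : ∀ {v} → S v ≡ true → ∀ u → -1ℤ ≤ℤ inflow (indicator S) v u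
  inflow-inside-≥-1 {v} Sv u with adj u v | S u | S v
  ... | false | _     | _    = -≤+
  ... | true  | false | true = ≤-refl
  ... | true  | true  | true = -≤+

  inflow-inside-nonneg : ∀ {u v} → S v ≡ true → (adj u v ≡ true → S u ≡ true) →
                         0ℤ ≤ℤ inflow (indicator S) v u
  inflow-inside-nonneg {u} {v} Sv uv⇒Su with adj u v | S u | S v | uv⇒Su
  ... | false | _     | _    | _  = ≤-refl
  ... | true  | true  | true | _  = ≤-refl
  ... | true  | false | true | Su with () ← Su refl

  module _ (F : List Cell) (D : Divisor) (v : Cell) where

    fireAt-outside-≥ : S v ≡ false → D v ≤ℤ fireAt F (indicator S) D v
    fireAt-outside-≥ Sv = i≤i+j (D v) _
      {{nonNegative (sum-nonneg F (λ u _ → inflow-outside-nonneg Sv u))}}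

    fireAt-outside-> : ∀ {u} → S v ≡ false → u ∈ F → adj u v ≡ true → S u ≡ true →
                       D v <ℤ fireAt F (indicator S) D v
    fireAt-outside-> Sv u∈F uv Su = ≤-<-trans (≤-reflexive (sym (+-identityʳ (D v))))
      (+-monoʳ-< (D v) (sum-pos (λ w _ → inflow-outside-nonneg Sv w) u∈F
                                (inflow-outside-pos Sv uv Su)))

    fireAt-inside-≥ : S v ≡ true → (∀ u → u ∈ F → adj u v ≡ true → S u ≡ true) →
                      D v ≤ℤ fireAt F (indicator S) D v
    fireAt-inside-≥ Sv neighbours-inside = i≤i+j (D v) _
      {{nonNegative (sum-nonneg F (λ u u∈F → inflow-inside-nonneg Sv (neighbours-inside u u∈F)))}}

    fireAt-inside-≥-1 : ∀ c → Unique F → S v ≡ true →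
                        (∀ u → u ∈ F → adj u v ≡ true → S u ≡ false → u ≡ c) →
                        D v - 1ℤ ≤ℤ fireAt F (indicator S) D v
    fireAt-inside-≥-1 c unique Sv only-c = +-monoʳ-≤ (D v)
      (sum-≥-1 _≟ᶜ_ c unique
        (λ u u∈F u≢c → inflow-inside-nonneg Sv (λ uv → ¬-not (λ Su → u≢c (only-c u u∈F uv Su))))
        (inflow-inside-≥-1 Sv c))

AtMostOneExit : List Cell → Divisor → (Cell → Bool) → Set
AtMostOneExit F D S = ∀ {v} → v ∈ F → S v ≡ true →
  ∃ λ c → (∀ u → u ∈ F → adj u v ≡ true → S u ≡ false → u ≡ c) × (c ∈ F → 1ℤ ≤ℤ D v)

fireAt-effective : ∀ {F D} S → Unique F → Effective F D → AtMostOneExit F D S →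
                   Effective F (fireAt F (indicator S) D)
fireAt-effective {F} {D} S unique D≥0 one-exit v v∈F = by-cases (S v) refl
  where
  -- Not `with S v`: that would also rewrite the S v hidden in the goal's summands.
  by-cases : ∀ s → S v ≡ s → 0ℤ ≤ℤ fireAt F (indicator S) D v
  by-cases false Sv = ≤-trans (D≥0 v v∈F) (fireAt-outside-≥ S F D v Sv)
  by-cases true  Sv with one-exit v∈F Sv
  ... | c , only-c , D≥1 with c ∈? F
  ...   | yes c∈F = ≤-trans (i≤j⇒0≤j-i (D≥1 c∈F)) (fireAt-inside-≥-1 S F D v c unique Sv only-c)
  ...   | no  c∉F = ≤-trans (D≥0 v v∈F) (fireAt-inside-≥ S F D v Sv
          (λ u u∈F u~v → ¬-not (λ Su → c∉F (subst (_∈ F) (only-c u u∈F u~v Su) u∈F))))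

∼-refl : ∀ {F D} → D ∼[ F ] D
∼-refl {F} {D} = const 0ℤ , λ v _ → sym (begin
  D v + sumℤ (map (inflow (const 0ℤ) v) F) ≡⟨ cong (D v +_) (sum-zero F (λ u → if-eta (adj u v))) ⟩
  D v + 0ℤ                                  ≡⟨ +-identityʳ (D v) ⟩
  D v                                       ∎)
  where open ≡-Reasoning

ChipReachable : List Cell → Divisor → Cell → Set
ChipReachable F D v =
  ∃ λ (D' : Divisor) → Effective F D' × (D ∼[ F ] D') × (0ℤ <ℤ D' v)

chipReachable-by-firing : ∀ {F D v} S → Effective F D → v ∈ F →
                          Effective F (fireAt F (indicator S) D) →
                          D v <ℤ fireAt F (indicator S) D v → ChipReachable F D v
chipReachable-by-firing {F} {D} S D≥0 v∈F fired≥0 gain =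
  fireAt F (indicator S) D , fired≥0 , (indicator S , λ _ _ → refl) , ≤-<-trans (D≥0 _ v∈F) gain

adj⇒sameLine : ∀ {c d a b} → adj (c , d) (a , b) ≡ true → c ≡ a ⊎ d ≡ b
adj⇒sameLine {c} {d} {a} {b} cd~ab with c ≟ a | d ≟ b
... | yes c≡a | _       = inj₁ c≡a
... | no _    | yes d≡b = inj₂ d≡b

adj-sameRow : ∀ {a a' b} → a ≢ a' → adj (a , b) (a' , b) ≡ true
adj-sameRow {a} {a'} {b} a≢a' with a ≟ a' | b ≟ b
... | yes a≡a' | _       = ⊥-elim (a≢a' a≡a')
... | no _     | yes _   = refl
... | no _     | no b≢b  = ⊥-elim (b≢b refl)

adj-sameColumn : ∀ {a b b'} → b ≢ b' → adj (a , b) (a , b') ≡ true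
adj-sameColumn {a} {b} {b'} b≢b' with a ≟ a | b ≟ b'
... | _      | yes b≡b' = ⊥-elim (b≢b' b≡b')
... | yes _  | no _     = refl
... | no a≢a | no _     = ⊥-elim (a≢a refl)

offColumn : ℕ → Cell → Bool
offColumn x (a , _) = not ⌊ x ≟ a ⌋

offRow : ℕ → Cell → Bool
offRow y (_ , b) = not ⌊ y ≟ b ⌋

offColumn-self : ∀ x b → offColumn x (x , b) ≡ false
offColumn-self x b with x ≟ x
... | yes _   = refl
... | no x≢x  = ⊥-elim (x≢x refl)

offRow-self : ∀ y a → offRow y (a , y) ≡ false
offRow-self y a with y ≟ y
... | yes _   = refl
... | no y≢y  = ⊥-elim (y≢y refl)

offColumn-≢ : ∀ {x a b} → x ≢ a → offColumn x (a , b) ≡ true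
offColumn-≢ {x} {a} x≢a with x ≟ a
... | yes x≡a = ⊥-elim (x≢a x≡a)
... | no _    = refl

offColumn-true : ∀ {x a b} → offColumn x (a , b) ≡ true → x ≢ a
offColumn-true {x} {a} offC with x ≟ a
... | no x≢a = x≢a

offRow-≢ : ∀ {y a b} → y ≢ b → offRow y (a , b) ≡ true
offRow-≢ {y} {b = b} y≢b with y ≟ b
... | yes y≡b = ⊥-elim (y≢b y≡b)
... | no _    = refl

offRow-true : ∀ {y a b} → offRow y (a , b) ≡ true → y ≢ b
offRow-true {y} {b = b} offR with y ≟ b
... | no y≢b = y≢b

column-neighbour : ∀ {x a b u} → x ≢ a → adj u (a , b) ≡ true →
                   offColumn x u ≡ false → u ≡ (x , b)
column-neighbour {x} {a} {b} {c , d} x≢a u~ab offC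
  with x ≟ c | adj⇒sameLine {c} {d} {a} {b} u~ab
... | yes refl | inj₁ x≡a  = ⊥-elim (x≢a x≡a)
... | yes refl | inj₂ refl = refl

row-neighbour : ∀ {y a b u} → y ≢ b → adj u (a , b) ≡ true →
                offRow y u ≡ false → u ≡ (a , y)
row-neighbour {y} {a} {b} {c , d} y≢b u~ab offR
  with y ≟ d | adj⇒sameLine {c} {d} {a} {b} u~ab
... | yes refl | inj₁ refl = refl
... | yes refl | inj₂ y≡b  = ⊥-elim (y≢b y≡b)

module _ {F : List Cell} (isF : IsFerrers F) where
  open IsFerrers isF

  ∈-firstColumn : ∀ {a b} → (a , b) ∈ F → (1 , b) ∈ F
  ∈-firstColumn {zero}  {b} 0b∈F with () ← positive 0 b 0b∈F
  ∈-firstColumn {suc a} {b} ab∈F = slideLeft a ab∈F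
    where
    slideLeft : ∀ k → (suc k , b) ∈ F → (1 , b) ∈ F
    slideLeft zero    k1∈F = k1∈F
    slideLeft (suc k) k2∈F = slideLeft k (closedˣ k b k2∈F)

  ∈-firstRow : ∀ {a b} → (a , b) ∈ F → (a , 1) ∈ F
  ∈-firstRow {a} {zero}  a0∈F with _ , () ← positive a 0 a0∈F
  ∈-firstRow {a} {suc b} ab∈F = slideDown b ab∈F
    where
    slideDown : ∀ k → (a , suc k) ∈ F → (a , 1) ∈ F
    slideDown zero    a1∈F = a1∈F
    slideDown (suc k) a2∈F = slideDown k (closedʸ a k a2∈F)

module _ {F : List Cell} {D : Divisor} (isF : IsFerrers F) (D≥0 : Effective F D) where
  open IsFerrers isF using (unique)

  column-chipReachable : ∀ {x b} → 1 < x → (x , b) ∈ F →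
    (∀ {a c} → (x , c) ∈ F → (a , c) ∈ F → x ≢ a → 1ℤ ≤ℤ D (a , c)) →
    ChipReachable F D (x , b)
  column-chipReachable {x} {b} 1<x xb∈F D≥1 =
    chipReachable-by-firing (offColumn x) D≥0 xb∈F
      (fireAt-effective (offColumn x) unique D≥0 one-exit)
      (fireAt-outside-> (offColumn x) F D (x , b) (offColumn-self x b) (∈-firstColumn isF xb∈F)
                        (adj-sameRow {b = b} (<⇒≢ 1<x)) (offColumn-≢ {b = b} (≢-sym (<⇒≢ 1<x))))
    where
    one-exit : AtMostOneExit F D (offColumn x)
    one-exit {a , b} ab∈F offC =
      (x , b) , (λ _ _ → column-neighbour x≢a) , (λ xb∈F → D≥1 xb∈F ab∈F x≢a)
      where
      x≢a : x ≢ a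
      x≢a = offColumn-true {b = b} offC

  row-chipReachable : ∀ {y a} → 1 < y → (a , y) ∈ F →
    (∀ {c b} → (c , y) ∈ F → (c , b) ∈ F → y ≢ b → 1ℤ ≤ℤ D (c , b)) →
    ChipReachable F D (a , y)
  row-chipReachable {y} {a} 1<y ay∈F D≥1 =
    chipReachable-by-firing (offRow y) D≥0 ay∈F
      (fireAt-effective (offRow y) unique D≥0 one-exit)
      (fireAt-outside-> (offRow y) F D (a , y) (offRow-self y a) (∈-firstRow isF ay∈F)
                        (adj-sameColumn {a = a} (<⇒≢ 1<y)) (offRow-≢ {a = a} (≢-sym (<⇒≢ 1<y))))
    where
    one-exit : AtMostOneExit F D (offRow y)
    one-exit {a , b} ab∈F offR =
      (a , y) , (λ _ _ → row-neighbour y≢b) , (λ ay∈F → D≥1 ay∈F ab∈F y≢b)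
      where
      y≢b : y ≢ b
      y≢b = offRow-true {a = a} offR

Dxy-nonneg : ∀ x y v → 0ℤ ≤ℤ Dxy x y v
Dxy-nonneg x y (a , b) with x ≟ a | y ≟ b
... | yes _ | _     = ≤-refl
... | no _  | yes _ = ≤-refl
... | no _  | no _  = +≤+ z≤n

Dxy-off : ∀ {x y a b} → x ≢ a → y ≢ b → Dxy x y (a , b) ≡ 1ℤ
Dxy-off {x} {y} {a} {b} x≢a y≢b with x ≟ a | y ≟ b
... | yes x≡a | _       = ⊥-elim (x≢a x≡a)
... | no _    | yes y≡b = ⊥-elim (y≢b y≡b)
... | no _    | no _    = refl

proposition3p1 : (F : List Cell) → IsFerrers F →
    (x y : ℕ) → 1 < x → 1 < y → (x , y) ∉ F → PositiveRank F (Dxy x y)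
proposition3p1 F isF x y 1<x 1<y xy∉F = D≥0 , chip
  where
  D≥0 : Effective F (Dxy x y)
  D≥0 v _ = Dxy-nonneg x y v

  chip : ∀ v → v ∈ F → ChipReachable F (Dxy x y) v
  chip (a , b) ab∈F with x ≟ a | y ≟ b
  ... | yes refl | _        = column-chipReachable isF D≥0 1<x ab∈F
          (λ xb∈F _ x≢a → ≤-reflexive (sym (Dxy-off x≢a (λ { refl → xy∉F xb∈F }))))
  ... | no _     | yes refl = row-chipReachable isF D≥0 1<y ab∈F
          (λ ay∈F _ y≢b → ≤-reflexive (sym (Dxy-off (λ { refl → xy∉F ay∈F }) y≢b)))
  ... | no x≢a   | no y≢b   =
          Dxy x y , D≥0 , ∼-refl , subst (0ℤ <ℤ_) (sym (Dxy-off x≢a y≢b)) (+<+ (s≤s z≤n))
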